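{- For integers $1<m<\sqrt{2n}$ (with $m\le n$), $$E_m\!\left[\frac1\ell\right]<\frac{1}{E_{m-1}[\ell]}.$$ For $1<m\le n$, $$E_m\!\left[\frac1\ell\right]\le\frac{1}{E_{m-1}[\ell]}+\frac{(m-1)(n-m)}{2n^2}.$$
   Context: Let $\mathbf X=\{X_1,\dots,X_n\}$ with uniform probability. For $1\le k\le n$, $\mathcal X_k$ is the set of finite sequences $\chi=(\chi_1,\dots,\chi_\ell)$ in $\mathbf X$ with $\{\chi_1,\dots,\chi_\ell\}$ of cardinality exactly $k$ and $\chi_\ell\ne\chi_j$ for $j<\ell$, with length $\ell=\ell(\chi)$ and probability $\mu(\chi)=n^{ -\ell(\chi)}$; $E_k$ denotes expectation on $\mathcal X_k$ (so under $E_k$, $\ell$ is the number of independent uniform draws until $k$ distinct objects have appeared; $E_k[\ell]=\sum_{j=0}^{k-1}\frac{n}{n-j}$). -}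

module Defs where

open import Data.Nat as ℕ using (ℕ; zero; suc; _∸_; _^_)
open import Data.Integer using (+_)
open import Data.Fin using (Fin)
open import Data.Fin.Properties using (_≟_)
open import Data.Bool using (Bool; true; false; _∧_; not)
open import Data.List using (List; []; _∷_; map; concatMap; length; filterᵇ; reverse; deduplicate)
open import Data.Bool.ListAction using (any)
open import Data.List.Base using (allFin)
open import Data.Rational using (ℚ; 0ℚ; _+_; _*_; _/_; 1/_; _≟_; ≢-nonZero)
open import Relation.Nullary using (yes; no)
open import Relation.Nullary.Decidable using (⌊_⌋)

seqs : (n L : ℕ) → List (List (Fin n))
seqs n zero    = [] ∷ []
seqs n (suc L) = concatMap (λ x → map (x ∷_) (seqs n L)) (allFin n)

card : {n : ℕ} → List (Fin n) → ℕ
card {n} χ = length (deduplicate Data.Fin.Properties._≟_ χ)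

-- Membership test for 𝒳_k: the set of entries has cardinality exactly k,
-- and the last entry differs from all previous ones (so ℓ ≥ 1).
lastNew : {n : ℕ} → List (Fin n) → Bool
lastNew χ with reverse χ
... | []       = false
... | y ∷ ys   = not (any (λ z → ⌊ y Data.Fin.Properties.≟ z ⌋) ys)

inX : {n : ℕ} → ℕ → List (Fin n) → Bool
inX k χ = ⌊ card χ ℕ.≟ k ⌋ ∧ lastNew χ

countX : (n k L : ℕ) → ℕ
countX n k L = length (filterᵇ (inX k) (seqs n L))

-- Total reciprocal on ℚ (value at 0 is irrelevant: only used on positive numbers).
inv : ℚ → ℚ
inv p with p Data.Rational.≟ 0ℚ
... | yes _  = 0ℚ
... | no p≢0 = 1/_ p {{≢-nonZero p≢0}}

fromℕ : ℕ → ℚ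
fromℕ k = (+ k) / 1

-- μ({χ ∈ 𝒳_k : ℓ(χ) = L}) / L  =  countX n k L / (L · n^L),  for L ≥ 1.
-- (if n = 0 then countX = 0, so the value of inv 0 is irrelevant.)
term : (n k L : ℕ) → ℚ
term n k L = fromℕ (countX n k (suc L)) * inv (fromℕ (suc L ℕ.* (n ^ suc L)))

-- Partial sums of E_k[1/ℓ] = Σ_{χ ∈ 𝒳_k} μ(χ)/ℓ(χ) over lengths 1..N.
-- (Elements of 𝒳_k have length ≥ 1.)  Terms are ≥ 0, so E_k[1/ℓ] = sup_N of these.
partialE1/ℓ : (n k N : ℕ) → ℚ
partialE1/ℓ n k zero    = 0ℚ
partialE1/ℓ n k (suc N) = partialE1/ℓ n k N + term n k N

-- E_k[ℓ] = Σ_{j=0}^{k-1} n/(n-j)   (closed form from the context);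
-- for j < k ≤ n, suc (n ∸ suc j) = n - j.
Eℓ : (n k : ℕ) → ℚ
Eℓ n zero    = 0ℚ
Eℓ n (suc j) = Eℓ n j + (+ n) / suc (n ∸ suc j)

{-# OPTIONS --safe #-}
module Submission where

-- Write m = k + 1 and think of h N c as an upper bound for E[1/ℓ | the first N draws show c ≤ k
-- distinct values].  If h is superharmonic for the coupon-collector chain,
--   n · h N c ≥ c · h (N+1) c + (n − c) · h (N+1) (c+1),   reading h (N+1) (k+1) as 1/(N+1),
-- then the partial sums of E_m[1/ℓ] plus the h-weighted probability of the paths that have not yet
-- reached m distinct values form a nonincreasing potential, whence E_m[1/ℓ] ≤ h 0 0.
-- We take h N c = 1/(N + E_k[ℓ] − E_c[ℓ] + τ(n−k)/(n−c)) with τ = (k+1)n/(k(n−k)+n): the expected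
-- number of remaining draws plus a correction, so that h 0 0 = 1/(E_k[ℓ] + τ(n−k)/n) < 1/E_k[ℓ].
-- Superharmonicity at c < k and at c = k reduces to two polynomial inequalities.

open import Defs
open import Data.Bool using (Bool; true; false; not; _∨_; if_then_else_)
open import Data.Bool.Properties using (∧-zeroʳ; ∧-identityʳ)
open import Data.Bool.ListAction using (any)
open import Data.Fin using (Fin)
open import Data.Fin.Properties using (_≟_)
import Data.Integer as ℤ
import Data.Integer.Properties as ℤP
open import Data.List using (List; []; _∷_; _++_; [_]; _∷ʳ_; map; concatMap; length; filter; reverse; deduplicate; allFin)
open import Data.List.Properties using (reverse-++; length-filter; length-tabulate)
open import Data.List.Membership.Propositional using (_∈_; _∉_)
open import Data.List.Membership.Propositional.Properties
  using (∈-allFin; ∈-filter⁺; ∈-filter⁻; ∈-deduplicate⁺; ∈-deduplicate⁻; ∈-++⁺ˡ; ∈-++⁺ʳ; ∈-++⁻; ∈-concatMap⁻; ∈-map⁻)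
open import Data.List.Membership.Propositional.Properties.WithK using (unique∧set⇒bag)
open import Data.List.Relation.Binary.BagAndSetEquality using (∼bag⇒↭)
open import Data.List.Relation.Binary.Permutation.Propositional.Properties using (↭-length)
open import Data.List.Relation.Unary.All using (All)
import Data.List.Relation.Unary.All.Properties as All
open import Data.List.Relation.Unary.Any as Any using (here; there)
import Data.List.Relation.Unary.Any.Properties as Any
open import Data.List.Relation.Unary.Unique.Propositional using (Unique; _∷_)
import Data.List.Relation.Unary.Unique.Propositional.Properties as Unique
open import Data.List.Relation.Unary.Unique.DecPropositional.Properties using (deduplicate-!)
import Data.Nat.Coprimality as Coprime
open import Data.Nat as ℕ using (ℕ; zero; suc; 2+; _∸_; _^_; z≤n; s≤s)
import Data.Nat.Properties as ℕP
import Data.Nat.Solver as ℕS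
open import Data.Product using (Σ; _×_; _,_; proj₂)
open import Data.Rational as ℚ using (ℚ; 0ℚ; 1ℚ; _+_; _*_; _-_; _/_; 1/_; _≤_; _<_)
import Data.Rational.Properties as ℚP
open import Data.Rational.Solver using (module +-*-Solver)
import Data.Rational.Unnormalised as ℚᵘ
import Data.Rational.Unnormalised.Properties as ℚᵘP
open import Data.Sum using (inj₁; inj₂)
open import Function using (_∘_; id; mk⇔; _⇔_; Equivalence)
open import Level using (0ℓ)
open import Relation.Binary.Definitions using (tri<; tri≈; tri>)
open import Relation.Binary.PropositionalEquality
  using (_≡_; _≢_; refl; sym; trans; cong; cong₂; subst; subst₂; module ≡-Reasoning)
open import Relation.Nullary using (yes; no; contradiction)
open import Relation.Nullary.Decidable using (⌊_⌋; does; T?; isYes≗does; dec-true; dec-false)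
open import Relation.Unary using (Pred; Decidable)
open import Relation.Unary.Properties using (∁?)

private
  variable
    A B : Set

⌜_⌝ : ℕ → ℚ
⌜ a ⌝ = fromℕ a

fromℕ-suc : ∀ a → ⌜ suc a ⌝ ≡ 1ℚ + ⌜ a ⌝
fromℕ-suc a rewrite ℚP.normalize-coprime (Coprime.sym (Coprime.1-coprimeTo a)) =
  cong (λ z → (ℤ.+ 1 ℤ.+ z) / 1) (sym (ℤP.*-identityʳ (ℤ.+ a)))

fromℕ-+ : ∀ a b → ⌜ a ℕ.+ b ⌝ ≡ ⌜ a ⌝ + ⌜ b ⌝
fromℕ-+ zero    b = sym (ℚP.+-identityˡ ⌜ b ⌝)
fromℕ-+ (suc a) b rewrite fromℕ-suc (a ℕ.+ b) | fromℕ-suc a | fromℕ-+ a b =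
  sym (ℚP.+-assoc 1ℚ ⌜ a ⌝ ⌜ b ⌝)

fromℕ-* : ∀ a b → ⌜ a ℕ.* b ⌝ ≡ ⌜ a ⌝ * ⌜ b ⌝
fromℕ-* zero    b = sym (ℚP.*-zeroˡ ⌜ b ⌝)
fromℕ-* (suc a) b rewrite fromℕ-+ b (a ℕ.* b) | fromℕ-suc a | fromℕ-* a b =
  solve 2 (λ x y → y :+ x :* y := (con 1ℚ :+ x) :* y) refl ⌜ a ⌝ ⌜ b ⌝
  where
  open +-*-Solver

fromℕ-nonNeg : ∀ a → 0ℚ ≤ ⌜ a ⌝
fromℕ-nonNeg a = ℚP.nonNegative⁻¹ _ {{ℚP.normalize-nonNeg a 1}}

fromℕ-pos : ∀ {a} → 0 ℕ.< a → 0ℚ < ⌜ a ⌝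
fromℕ-pos {suc a} _ = ℚP.positive⁻¹ _ {{ℚP.normalize-pos (suc a) 1}}

fromℕ-∸-pos : ∀ {n j} → j ℕ.< n → 0ℚ < ⌜ n ∸ j ⌝
fromℕ-∸-pos j<n = fromℕ-pos (ℕP.m<n⇒0<n∸m j<n)

^-pos : ∀ {m} L → 0 ℕ.< m → 0 ℕ.< m ^ L
^-pos {m} L 0<m = ℕ.>-nonZero⁻¹ (m ^ L) {{ℕP.m^n≢0 m L {{ℕ.>-nonZero 0<m}}}}

p≤p+q : ∀ {p q} → 0ℚ ≤ q → p ≤ p + q
p≤p+q {p} {q} 0≤q = subst (_≤ p + q) (ℚP.+-identityʳ p) (ℚP.+-monoʳ-≤ p 0≤q)

p<p+q : ∀ {p q} → 0ℚ < q → p < p + q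
p<p+q {p} {q} 0<q = subst (_< p + q) (ℚP.+-identityʳ p) (ℚP.+-monoʳ-< p 0<q)

p+g≡q⇒p≤q : ∀ {p q} g → 0ℚ ≤ g → p + g ≡ q → p ≤ q
p+g≡q⇒p≤q {p} g 0≤g eq = subst (p ≤_) eq (p≤p+q 0≤g)

p≤q⇒0≤q-p : ∀ {p q} → p ≤ q → 0ℚ ≤ q - p
p≤q⇒0≤q-p {p} {q} p≤q = subst (_≤ q - p) (ℚP.+-inverseʳ p) (ℚP.+-monoˡ-≤ (ℚ.- p) p≤q)

p<q⇒0<q-p : ∀ {p q} → p < q → 0ℚ < q - p
p<q⇒0<q-p {p} {q} p<q = subst (_< q - p) (ℚP.+-inverseʳ p) (ℚP.+-monoˡ-< (ℚ.- p) p<q)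

p+q≤r⇒q≤r-p : ∀ {p q r} → p + q ≤ r → q ≤ r - p
p+q≤r⇒q≤r-p {p} {q} {r} p+q≤r =
  subst (_≤ r - p) (solve 2 (λ p q → p :+ q :- p := q) refl p q) (ℚP.+-monoˡ-≤ (ℚ.- p) p+q≤r)
  where
  open +-*-Solver

fromℕ-mono-≤ : ∀ {a b} → a ℕ.≤ b → ⌜ a ⌝ ≤ ⌜ b ⌝
fromℕ-mono-≤ {a} {b} a≤b = p+g≡q⇒p≤q ⌜ b ∸ a ⌝ (fromℕ-nonNeg (b ∸ a))
  (trans (sym (fromℕ-+ a (b ∸ a))) (cong ⌜_⌝ (ℕP.m+[n∸m]≡n a≤b)))

+-nonNeg : ∀ {p q} → 0ℚ ≤ p → 0ℚ ≤ q → 0ℚ ≤ p + q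
+-nonNeg 0≤p 0≤q = ℚP.≤-trans 0≤p (p≤p+q 0≤q)

+-nonNeg-pos : ∀ {p q} → 0ℚ ≤ p → 0ℚ < q → 0ℚ < p + q
+-nonNeg-pos {p} {q} 0≤p 0<q = ℚP.<-≤-trans 0<q (subst (_≤ p + q) (ℚP.+-identityˡ q) (ℚP.+-monoˡ-≤ q 0≤p))

*-nonNeg : ∀ {p q} → 0ℚ ≤ p → 0ℚ ≤ q → 0ℚ ≤ p * q
*-nonNeg {p} {q} 0≤p 0≤q = ℚP.nonNegative⁻¹ _
  {{ℚP.nonNeg*nonNeg⇒nonNeg p {{ℚ.nonNegative 0≤p}} q {{ℚ.nonNegative 0≤q}}}}

*-pos : ∀ {p q} → 0ℚ < p → 0ℚ < q → 0ℚ < p * q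
*-pos {p} {q} 0<p 0<q = ℚP.positive⁻¹ _ {{ℚP.pos*pos⇒pos p {{ℚ.positive 0<p}} q {{ℚ.positive 0<q}}}}

*-monoˡ-≤ : ∀ {r p q} → 0ℚ ≤ r → p ≤ q → r * p ≤ r * q
*-monoˡ-≤ {r} 0≤r = ℚP.*-monoˡ-≤-nonNeg r {{ℚ.nonNegative 0≤r}}

*-monoʳ-≤ : ∀ {r p q} → 0ℚ ≤ r → p ≤ q → p * r ≤ q * r
*-monoʳ-≤ {r} 0≤r = ℚP.*-monoʳ-≤-nonNeg r {{ℚ.nonNegative 0≤r}}

*-monoˡ-< : ∀ {r p q} → 0ℚ < r → p < q → r * p < r * q
*-monoˡ-< {r} 0<r = ℚP.*-monoʳ-<-pos r {{ℚ.positive 0<r}}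

*-monoʳ-< : ∀ {r p q} → 0ℚ < r → p < q → p * r < q * r
*-monoʳ-< {r} 0<r = ℚP.*-monoˡ-<-pos r {{ℚ.positive 0<r}}

inv-inverseʳ : ∀ {p} → 0ℚ < p → p * inv p ≡ 1ℚ
inv-inverseʳ {p} 0<p with p ℚ.≟ 0ℚ
... | yes refl = contradiction 0<p (ℚP.<-irrefl refl)
... | no  p≢0  = ℚP.*-inverseʳ p {{ℚ.≢-nonZero p≢0}}

inv-pos : ∀ {p} → 0ℚ < p → 0ℚ < inv p
inv-pos {p} 0<p with p ℚ.≟ 0ℚ
... | yes refl = contradiction 0<p (ℚP.<-irrefl refl)
... | no  _    = ℚP.positive⁻¹ _ {{ℚP.1/pos⇒pos p {{ℚ.positive 0<p}}}}

inv-nonNeg : ∀ {p} → 0ℚ ≤ p → 0ℚ ≤ inv p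
inv-nonNeg {p} 0≤p with ℚP.<-cmp 0ℚ p
... | tri< 0<p _ _  = ℚP.<⇒≤ (inv-pos 0<p)
... | tri≈ _ refl _ = ℚP.≤-refl
... | tri> _ _ p<0  = contradiction (ℚP.<-≤-trans p<0 0≤p) (ℚP.<-irrefl refl)

inv-unique : ∀ {p q} → p * q ≡ 1ℚ → inv p ≡ q
inv-unique {p} {q} pq≡1 with p ℚ.≟ 0ℚ
... | yes refl = contradiction (trans (sym (ℚP.*-zeroˡ q)) pq≡1) (λ ())
... | no  p≢0  = begin
  1/ p                ≡⟨ ℚP.*-identityʳ (1/ p) ⟨
  1/ p * 1ℚ           ≡⟨ cong (1/ p *_) pq≡1 ⟨
  1/ p * (p * q)      ≡⟨ ℚP.*-assoc (1/ p) p q ⟨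
  1/ p * p * q        ≡⟨ cong (_* q) (ℚP.*-inverseˡ p) ⟩
  1ℚ * q              ≡⟨ ℚP.*-identityˡ q ⟩
  q                   ∎
  where
  open ≡-Reasoning
  instance _ = ℚ.≢-nonZero p≢0

inv-* : ∀ {p q} → 0ℚ < p → 0ℚ < q → inv (p * q) ≡ inv p * inv q
inv-* {p} {q} 0<p 0<q = inv-unique {p * q} (begin
  p * q * (inv p * inv q)
    ≡⟨ solve 4 (λ p q p′ q′ → p :* q :* (p′ :* q′) := (p :* p′) :* (q :* q′)) refl p q (inv p) (inv q) ⟩
  (p * inv p) * (q * inv q)   ≡⟨ cong₂ _*_ (inv-inverseʳ 0<p) (inv-inverseʳ 0<q) ⟩
  1ℚ                          ∎)
  where
  open ≡-Reasoning
  open +-*-Solver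

inv-antimono-< : ∀ {p q} → 0ℚ < p → p < q → inv q < inv p
inv-antimono-< {p} {q} 0<p p<q = begin-strict
  inv q                   ≡⟨ ℚP.*-identityʳ (inv q) ⟨
  inv q * 1ℚ              ≡⟨ cong (inv q *_) (inv-inverseʳ 0<p) ⟨
  inv q * (p * inv p)     ≡⟨ ℚP.*-assoc (inv q) p (inv p) ⟨
  inv q * p * inv p       <⟨ *-monoʳ-< (inv-pos 0<p) (*-monoˡ-< (inv-pos 0<q) p<q) ⟩
  inv q * q * inv p       ≡⟨ cong (_* inv p) (trans (ℚP.*-comm (inv q) q) (inv-inverseʳ 0<q)) ⟩
  1ℚ * inv p              ≡⟨ ℚP.*-identityˡ (inv p) ⟩
  inv p                   ∎
  where
  open ℚP.≤-Reasoning
  0<q : 0ℚ < q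
  0<q = ℚP.<-trans 0<p p<q

inv-antimono-≤ : ∀ {p q} → 0ℚ < p → p ≤ q → inv q ≤ inv p
inv-antimono-≤ {p} {q} 0<p p≤q with ℚP.<-cmp p q
... | tri< p<q _ _  = ℚP.<⇒≤ (inv-antimono-< 0<p p<q)
... | tri≈ _ refl _ = ℚP.≤-refl
... | tri> _ _ q<p  = contradiction (ℚP.<-≤-trans q<p p≤q) (ℚP.<-irrefl refl)

weighted-inv-≤ : ∀ {K M x y} → 0ℚ < x → 0ℚ < y → M * (x + 1ℚ) * (x - y) ≤ K * y →
                 K * inv (x + 1ℚ) + M * inv y ≤ (K + M) * inv x
weighted-inv-≤ {K} {M} {x} {y} 0<x 0<y cond = begin
  K * inv x₁ + M * inv y                    ≡⟨ cong₂ (λ a b → K * a + M * b) (inv-unique {x₁} x₁·) (inv-unique {y} y·) ⟩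
  K * (x * y * W) + M * (x * x₁ * W)        ≡⟨ solve 6 (λ K M x x₁ y W → K :* (x :* y :* W) :+ M :* (x :* x₁ :* W)
                                                 := (K :* x :* y :+ M :* x :* x₁) :* W) refl K M x x₁ y W ⟩
  (K * x * y + M * x * x₁) * W              ≤⟨ *-monoʳ-≤ 0≤W (p+g≡q⇒p≤q {K * x * y + M * x * x₁} gap (p≤q⇒0≤q-p cond) gap-eq) ⟩
  (K + M) * x₁ * y * W                      ≡⟨ solve 5 (λ K M x₁ y W → (K :+ M) :* x₁ :* y :* W := (K :+ M) :* (x₁ :* y :* W))
                                                 refl K M x₁ y W ⟩
  (K + M) * (x₁ * y * W)                    ≡⟨ cong ((K + M) *_) (inv-unique {x} x·) ⟨
  (K + M) * inv x                           ∎
  where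
  open ℚP.≤-Reasoning
  open +-*-Solver
  x₁ W gap : ℚ
  x₁ = x + 1ℚ
  W = inv x * inv x₁ * inv y
  gap = K * y - M * x₁ * (x - y)
  0<x₁ : 0ℚ < x₁
  0<x₁ = ℚP.<-trans 0<x (p<p+q (ℚP.positive⁻¹ 1ℚ))
  0≤W : 0ℚ ≤ W
  0≤W = *-nonNeg (*-nonNeg (inv-nonNeg (ℚP.<⇒≤ 0<x)) (inv-nonNeg (ℚP.<⇒≤ 0<x₁))) (inv-nonNeg (ℚP.<⇒≤ 0<y))
  1≡xx₁y : 1ℚ ≡ (x * inv x) * (x₁ * inv x₁) * (y * inv y)
  1≡xx₁y = sym (cong₂ _*_ (cong₂ _*_ (inv-inverseʳ 0<x) (inv-inverseʳ 0<x₁)) (inv-inverseʳ 0<y))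
  x· : x * (x₁ * y * W) ≡ 1ℚ
  x· = trans (solve 6 (λ a b c a′ b′ c′ → a :* (b :* c :* (a′ :* b′ :* c′)) := (a :* a′) :* (b :* b′) :* (c :* c′))
                refl x x₁ y (inv x) (inv x₁) (inv y)) (sym 1≡xx₁y)
  x₁· : x₁ * (x * y * W) ≡ 1ℚ
  x₁· = trans (solve 6 (λ a b c a′ b′ c′ → b :* (a :* c :* (a′ :* b′ :* c′)) := (a :* a′) :* (b :* b′) :* (c :* c′))
                 refl x x₁ y (inv x) (inv x₁) (inv y)) (sym 1≡xx₁y)
  y· : y * (x * x₁ * W) ≡ 1ℚ
  y· = trans (solve 6 (λ a b c a′ b′ c′ → c :* (a :* b :* (a′ :* b′ :* c′)) := (a :* a′) :* (b :* b′) :* (c :* c′))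
                refl x x₁ y (inv x) (inv x₁) (inv y)) (sym 1≡xx₁y)
  gap-eq : K * x * y + M * x * x₁ + gap ≡ (K + M) * x₁ * y
  gap-eq = solve 4 (λ K M x y → K :* x :* y :+ M :* x :* (x :+ con 1ℚ) :+ (K :* y :- M :* (x :+ con 1ℚ) :* (x :- y))
                                := (K :+ M) :* (x :+ con 1ℚ) :* y) refl K M x y

weighted-inv-condition : ∀ {c j u q x} → j * u ≡ 1ℚ → c * u * (c + j) ≤ q * (x + 1ℚ) + c * u * q →
                         j * (x + 1ℚ) * (u * (c - q)) ≤ c * (x - u * (c - q))
weighted-inv-condition {c} {j} {u} {q} {x} ju≡1 hyp = p+g≡q⇒p≤q gap (p≤q⇒0≤q-p hyp) (begin
  j * (x + 1ℚ) * (u * (c - q)) + gap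
    ≡⟨ solve 5 (λ c j u q x → let x₁ = x :+ con 1ℚ in
                  j :* x₁ :* (u :* (c :- q)) :+ ((q :* x₁ :+ c :* u :* q) :- c :* u :* (c :+ j))
                  := c :* (x :- u :* (c :- q)) :+ (j :* u :- con 1ℚ) :* (x₁ :* (c :- q) :- c))
         refl c j u q x ⟩
  c * (x - u * (c - q)) + (j * u - 1ℚ) * Q  ≡⟨ cong (λ e → c * (x - u * (c - q)) + (e - 1ℚ) * Q) ju≡1 ⟩
  c * (x - u * (c - q)) + (1ℚ - 1ℚ) * Q
    ≡⟨ solve 2 (λ r Q → r :+ (con 1ℚ :- con 1ℚ) :* Q := r) refl (c * (x - u * (c - q))) Q ⟩
  c * (x - u * (c - q))                     ∎)
  where
  open ≡-Reasoning
  open +-*-Solver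
  gap Q : ℚ
  gap = (q * (x + 1ℚ) + c * u * q) - c * u * (c + j)
  Q = (x + 1ℚ) * (c - q) - c

∑ : List A → (A → ℚ) → ℚ
∑ []       f = 0ℚ
∑ (x ∷ xs) f = f x + ∑ xs f

syntax ∑ xs (λ x → e) = ∑[ x ∈ xs ] e

∑-cong : ∀ xs {f g : A → ℚ} → (∀ x → f x ≡ g x) → ∑ xs f ≡ ∑ xs g
∑-cong []       f≗g = refl
∑-cong (x ∷ xs) f≗g = cong₂ _+_ (f≗g x) (∑-cong xs f≗g)

∑-++ : ∀ xs ys (f : A → ℚ) → ∑ (xs ++ ys) f ≡ ∑ xs f + ∑ ys f
∑-++ []       ys f = sym (ℚP.+-identityˡ _)
∑-++ (x ∷ xs) ys f = trans (cong (f x +_) (∑-++ xs ys f)) (sym (ℚP.+-assoc (f x) _ _))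

∑-map : ∀ (g : A → B) xs (f : B → ℚ) → ∑ (map g xs) f ≡ ∑ xs (f ∘ g)
∑-map g []       f = refl
∑-map g (x ∷ xs) f = cong (f (g x) +_) (∑-map g xs f)

∑-concatMap : ∀ (g : A → List B) xs (f : B → ℚ) → ∑ (concatMap g xs) f ≡ ∑[ x ∈ xs ] ∑ (g x) f
∑-concatMap g []       f = refl
∑-concatMap g (x ∷ xs) f = trans (∑-++ (g x) _ f) (cong (∑ (g x) f +_) (∑-concatMap g xs f))

∑-+ : ∀ xs (f g : A → ℚ) → ∑[ x ∈ xs ] (f x + g x) ≡ ∑ xs f + ∑ xs g
∑-+ []       f g = refl
∑-+ (x ∷ xs) f g rewrite ∑-+ xs f g =
  solve 4 (λ a b c d → (a :+ b) :+ (c :+ d) := (a :+ c) :+ (b :+ d)) refl (f x) (g x) (∑ xs f) (∑ xs g)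
  where
  open +-*-Solver

∑-*ˡ : ∀ a xs (f : A → ℚ) → ∑[ x ∈ xs ] (a * f x) ≡ a * ∑ xs f
∑-*ˡ a []       f = sym (ℚP.*-zeroʳ a)
∑-*ˡ a (x ∷ xs) f rewrite ∑-*ˡ a xs f = sym (ℚP.*-distribˡ-+ a (f x) (∑ xs f))

∑-mono-≤ : ∀ {xs} {f g : A → ℚ} → (∀ {x} → x ∈ xs → f x ≤ g x) → ∑ xs f ≤ ∑ xs g
∑-mono-≤ {xs = []}     f≤g = ℚP.≤-refl
∑-mono-≤ {xs = x ∷ xs} f≤g = ℚP.+-mono-≤ (f≤g (here refl)) (∑-mono-≤ (f≤g ∘ there))

∑-nonNeg : ∀ {xs} {f : A → ℚ} → (∀ {x} → x ∈ xs → 0ℚ ≤ f x) → 0ℚ ≤ ∑ xs f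
∑-nonNeg {xs = []}     0≤f = ℚP.≤-refl
∑-nonNeg {xs = x ∷ xs} 0≤f = ℚP.+-mono-≤ (0≤f (here refl)) (∑-nonNeg (0≤f ∘ there))

∑-split : ∀ {P : Pred A 0ℓ} (P? : Decidable P) xs (g : Bool → ℚ) →
          ∑[ x ∈ xs ] g (does (P? x)) ≡
          ⌜ length (filter P? xs) ⌝ * g true + ⌜ length (filter (∁? P?) xs) ⌝ * g false
∑-split P? []       g = solve 2 (λ a b → con 0ℚ := con 0ℚ :* a :+ con 0ℚ :* b) refl (g true) (g false)
  where
  open +-*-Solver
∑-split P? (x ∷ xs) g with does (P? x)
... | true  rewrite ∑-split P? xs g | fromℕ-suc (length (filter P? xs)) =
  solve 4 (λ a b p q → a :+ (p :* a :+ q :* b) := (con 1ℚ :+ p) :* a :+ q :* b) refl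
    (g true) (g false) ⌜ length (filter P? xs) ⌝ ⌜ length (filter (∁? P?) xs) ⌝
  where
  open +-*-Solver
... | false rewrite ∑-split P? xs g | fromℕ-suc (length (filter (∁? P?) xs)) =
  solve 4 (λ a b p q → b :+ (p :* a :+ q :* b) := p :* a :+ (con 1ℚ :+ q) :* b) refl
    (g true) (g false) ⌜ length (filter P? xs) ⌝ ⌜ length (filter (∁? P?) xs) ⌝
  where
  open +-*-Solver

length-filter+filter-∁ : ∀ {P : Pred A 0ℓ} (P? : Decidable P) xs →
                         length (filter P? xs) ℕ.+ length (filter (∁? P?) xs) ≡ length xs
length-filter+filter-∁ P? []       = refl
length-filter+filter-∁ P? (x ∷ xs) with does (P? x)
... | true  = cong suc (length-filter+filter-∁ P? xs)
... | false = trans (ℕP.+-suc _ _) (cong suc (length-filter+filter-∁ P? xs))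

∑-seqs-∷ : ∀ n L (f : List (Fin n) → ℚ) →
           ∑ (seqs n (suc L)) f ≡ ∑[ x ∈ allFin n ] ∑[ χ ∈ seqs n L ] f (x ∷ χ)
∑-seqs-∷ n L f = trans (∑-concatMap _ (allFin n) f) (∑-cong (allFin n) (λ x → ∑-map (x ∷_) (seqs n L) f))

∑-seqs-∷ʳ : ∀ n L (f : List (Fin n) → ℚ) →
            ∑ (seqs n (suc L)) f ≡ ∑[ ψ ∈ seqs n L ] ∑[ x ∈ allFin n ] f (ψ ∷ʳ x)
∑-seqs-∷ʳ n zero f = begin
  ∑ (seqs n 1) f                      ≡⟨ ∑-seqs-∷ n 0 f ⟩
  ∑[ x ∈ allFin n ] (f [ x ] + 0ℚ)    ≡⟨ ∑-cong (allFin n) (λ x → ℚP.+-identityʳ (f [ x ])) ⟩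
  ∑[ x ∈ allFin n ] f [ x ]           ≡⟨ ℚP.+-identityʳ _ ⟨
  ∑[ x ∈ allFin n ] f [ x ] + 0ℚ      ∎
  where
  open ≡-Reasoning
∑-seqs-∷ʳ n (suc L) f = begin
  ∑ (seqs n (2+ L)) f
    ≡⟨ ∑-seqs-∷ n (suc L) f ⟩
  ∑[ x ∈ allFin n ] ∑[ χ ∈ seqs n (suc L) ] f (x ∷ χ)
    ≡⟨ ∑-cong (allFin n) (λ x → ∑-seqs-∷ʳ n L (f ∘ (x ∷_))) ⟩
  ∑[ x ∈ allFin n ] ∑[ ψ ∈ seqs n L ] ∑[ y ∈ allFin n ] f (x ∷ ψ ∷ʳ y)
    ≡⟨ ∑-seqs-∷ n L _ ⟨
  ∑[ ψ ∈ seqs n (suc L) ] ∑[ y ∈ allFin n ] f (ψ ∷ʳ y)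
    ∎
  where
  open ≡-Reasoning

length-∈-seqs : ∀ {n L χ} → χ ∈ seqs n L → length χ ≡ L
length-∈-seqs {L = zero}  (here refl) = refl
length-∈-seqs {n} {suc L} χ∈
  with _ , χ∈map ← Any.satisfied (∈-concatMap⁻ (λ x → map (x ∷_) (seqs n L)) {xs = allFin n} χ∈)
  with _ , ψ∈ , refl ← ∈-map⁻ _ χ∈map
  = cong suc (length-∈-seqs ψ∈)

module _ {n : ℕ} where

  open import Data.List.Membership.DecPropositional (_≟_ {n}) using (_∈?_)

  card≤length : ∀ (χ : List (Fin n)) → card χ ℕ.≤ length χ
  card≤length []      = z≤n
  card≤length (x ∷ χ) = s≤s (ℕP.≤-trans (length-filter _ (deduplicate _≟_ χ)) (card≤length χ))

  card≡length : ∀ {χ ys : List (Fin n)} → Unique ys → (∀ {z} → z ∈ χ ⇔ z ∈ ys) → card χ ≡ length ys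
  card≡length {χ} ys! χ≈ys = ↭-length (∼bag⇒↭ (unique∧set⇒bag (deduplicate-! _≟_ χ) ys!
    (λ {z} → mk⇔ (to χ≈ys ∘ ∈-deduplicate⁻ _≟_ χ) (∈-deduplicate⁺ _≟_ ∘ from χ≈ys))))
    where
    open Equivalence

  length-members : ∀ ψ → length (filter (_∈? ψ) (allFin n)) ≡ card ψ
  length-members ψ = sym (card≡length (Unique.filter⁺ (_∈? ψ) (Unique.allFin⁺ n))
    (mk⇔ (∈-filter⁺ (_∈? ψ) (∈-allFin _)) (proj₂ ∘ ∈-filter⁻ (_∈? ψ) {xs = allFin n})))

  length-nonMembers : ∀ ψ → length (filter (∁? (_∈? ψ)) (allFin n)) ≡ n ∸ card ψ
  length-nonMembers ψ = begin
    #out                                   ≡⟨ ℕP.m+n∸m≡n (card ψ) #out ⟨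
    card ψ ℕ.+ #out ∸ card ψ               ≡⟨ cong (λ c → c ℕ.+ #out ∸ card ψ) (length-members ψ) ⟨
    #in ℕ.+ #out ∸ card ψ                  ≡⟨ cong (_∸ card ψ) (length-filter+filter-∁ (_∈? ψ) (allFin n)) ⟩
    length (allFin n) ∸ card ψ             ≡⟨ cong (_∸ card ψ) (length-tabulate id) ⟩
    n ∸ card ψ                             ∎
    where
    open ≡-Reasoning
    #in #out : ℕ
    #in = length (filter (_∈? ψ) (allFin n))
    #out = length (filter (∁? (_∈? ψ)) (allFin n))

  card-∷ʳ-∈ : ∀ {ψ x} → x ∈ ψ → card (ψ ∷ʳ x) ≡ card ψ
  card-∷ʳ-∈ {ψ} {x} x∈ψ = card≡length (deduplicate-! _≟_ ψ) (mk⇔ to (∈-++⁺ˡ ∘ ∈-deduplicate⁻ _≟_ ψ))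
    where
    to : ∀ {z} → z ∈ ψ ∷ʳ x → z ∈ deduplicate _≟_ ψ
    to z∈ with ∈-++⁻ ψ z∈
    ... | inj₁ z∈ψ         = ∈-deduplicate⁺ _≟_ z∈ψ
    ... | inj₂ (here refl) = ∈-deduplicate⁺ _≟_ x∈ψ

  card-∷ʳ-∉ : ∀ {ψ x} → x ∉ ψ → card (ψ ∷ʳ x) ≡ suc (card ψ)
  card-∷ʳ-∉ {ψ} {x} x∉ψ = card≡length (x∉dedup ∷ deduplicate-! _≟_ ψ) (mk⇔ to from)
    where
    x∉dedup : All (x ≢_) (deduplicate _≟_ ψ)
    x∉dedup = All.¬Any⇒All¬ _ (x∉ψ ∘ ∈-deduplicate⁻ _≟_ ψ)
    to : ∀ {z} → z ∈ ψ ∷ʳ x → z ∈ x ∷ deduplicate _≟_ ψ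
    to z∈ with ∈-++⁻ ψ z∈
    ... | inj₁ z∈ψ         = there (∈-deduplicate⁺ _≟_ z∈ψ)
    ... | inj₂ (here refl) = here refl
    from : ∀ {z} → z ∈ x ∷ deduplicate _≟_ ψ → z ∈ ψ ∷ʳ x
    from (here refl) = ∈-++⁺ʳ ψ (here refl)
    from (there z∈)  = ∈-++⁺ˡ (∈-deduplicate⁻ _≟_ ψ z∈)

  lastNew-∷ʳ : ∀ ψ x → lastNew (ψ ∷ʳ x) ≡ not (does (x ∈? ψ))
  lastNew-∷ʳ ψ x rewrite reverse-++ ψ [ x ] = cong not (trans (any≡does (reverse ψ)) does-reverse)
    where
    any≡does : ∀ ys → any (λ z → ⌊ x ≟ z ⌋) ys ≡ does (x ∈? ys)
    any≡does []       = refl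
    any≡does (y ∷ ys) = cong₂ _∨_ (isYes≗does (x ≟ y)) (any≡does ys)
    does-reverse : does (x ∈? reverse ψ) ≡ does (x ∈? ψ)
    does-reverse with x ∈? ψ
    ... | yes x∈ψ = dec-true (x ∈? reverse ψ) (Any.reverse⁺ x∈ψ)
    ... | no  x∉ψ = dec-false (x ∈? reverse ψ) (x∉ψ ∘ Any.reverse⁻)

  inX-∷ʳ-∈ : ∀ m {ψ x} → x ∈ ψ → inX m (ψ ∷ʳ x) ≡ false
  inX-∷ʳ-∈ m {ψ} {x} x∈ψ rewrite lastNew-∷ʳ ψ x | dec-true (x ∈? ψ) x∈ψ = ∧-zeroʳ _

  inX-∷ʳ-∉ : ∀ m {ψ x} → x ∉ ψ → inX m (ψ ∷ʳ x) ≡ ⌊ suc (card ψ) ℕ.≟ m ⌋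
  inX-∷ʳ-∉ m {ψ} {x} x∉ψ rewrite lastNew-∷ʳ ψ x | dec-false (x ∈? ψ) x∉ψ | card-∷ʳ-∉ x∉ψ = ∧-identityʳ _

-- Superharmonic majorants of 1/ℓ

if-≟-≢ : ∀ {a b} {x y : A} → a ≢ b → (if ⌊ a ℕ.≟ b ⌋ then x else y) ≡ y
if-≟-≢ {a = a} {b} a≢b with a ℕ.≟ b
... | yes a≡b = contradiction a≡b a≢b
... | no  _   = refl

if-≟-≡ : ∀ a {x y : A} → (if ⌊ a ℕ.≟ a ⌋ then x else y) ≡ x
if-≟-≡ a with a ℕ.≟ a
... | yes _   = refl
... | no  a≢a = contradiction refl a≢a

record Superharmonic (n k : ℕ) (h : ℕ → ℕ → ℚ) : Set where
  field
    nonNeg : ∀ N c → c ℕ.≤ k → 0ℚ ≤ h N c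
    draw   : ∀ N c → c ℕ.< k → c ℕ.≤ N →
             ⌜ c ⌝ * h (suc N) c + ⌜ n ∸ c ⌝ * h (suc N) (suc c) ≤ ⌜ n ⌝ * h N c
    absorb : ∀ N → k ℕ.≤ N →
             ⌜ k ⌝ * h (suc N) k + ⌜ n ∸ k ⌝ * inv ⌜ suc N ⌝ ≤ ⌜ n ⌝ * h N k

module _ {n k : ℕ} {h : ℕ → ℕ → ℚ} (0<n : 0 ℕ.< n) (h-super : Superharmonic n k h) where

  open Superharmonic h-super
  open import Data.List.Membership.DecPropositional (_≟_ {n}) using (_∈?_)

  value : ℕ → ℕ → ℚ
  value N c with c ℕ.≤? k
  ... | yes _ = h N c
  ... | no  _ = 0ℚ

  value-live : ∀ {N c} → c ℕ.≤ k → value N c ≡ h N c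
  value-live {N} {c} c≤k with c ℕ.≤? k
  ... | yes _   = refl
  ... | no  c≰k = contradiction c≤k c≰k

  value-dead : ∀ {N c} → k ℕ.< c → value N c ≡ 0ℚ
  value-dead {N} {c} k<c with c ℕ.≤? k
  ... | yes c≤k = contradiction k<c (ℕP.≤⇒≯ c≤k)
  ... | no  _   = refl

  value-nonNeg : ∀ N c → 0ℚ ≤ value N c
  value-nonNeg N c with c ℕ.≤? k
  ... | yes c≤k = nonNeg N c c≤k
  ... | no  _   = ℚP.≤-refl

  payoff : ℕ → List (Fin n) → ℚ
  payoff N χ = (if inX (suc k) χ then inv ⌜ N ⌝ else 0ℚ) + value N (card χ)

  afterDraw : ℕ → ℕ → Bool → ℚ
  afterDraw N c true  = value N c
  afterDraw N c false = (if ⌊ suc c ℕ.≟ suc k ⌋ then inv ⌜ N ⌝ else 0ℚ) + value N (suc c)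

  payoff-∷ʳ : ∀ N ψ x → payoff N (ψ ∷ʳ x) ≡ afterDraw N (card ψ) (does (x ∈? ψ))
  payoff-∷ʳ N ψ x with x ∈? ψ
  ... | yes x∈ψ rewrite inX-∷ʳ-∈ (suc k) x∈ψ | card-∷ʳ-∈ x∈ψ = ℚP.+-identityˡ _
  ... | no  x∉ψ rewrite inX-∷ʳ-∉ (suc k) x∉ψ | card-∷ʳ-∉ x∉ψ = refl

  afterDraw-live : ∀ {N c} → c ℕ.< k → afterDraw N c false ≡ h N (suc c)
  afterDraw-live {N} {c} c<k = begin
    (if ⌊ suc c ℕ.≟ suc k ⌋ then inv ⌜ N ⌝ else 0ℚ) + value N (suc c)
      ≡⟨ cong₂ _+_ (if-≟-≢ (ℕP.<⇒≢ (s≤s c<k))) (value-live c<k) ⟩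
    0ℚ + h N (suc c)  ≡⟨ ℚP.+-identityˡ _ ⟩
    h N (suc c)       ∎
    where
    open ≡-Reasoning

  afterDraw-absorb : ∀ {N} → afterDraw N k false ≡ inv ⌜ N ⌝
  afterDraw-absorb {N} = begin
    (if ⌊ suc k ℕ.≟ suc k ⌋ then inv ⌜ N ⌝ else 0ℚ) + value N (suc k)
      ≡⟨ cong₂ _+_ (if-≟-≡ (suc k)) (value-dead (ℕP.n<1+n k)) ⟩
    inv ⌜ N ⌝ + 0ℚ    ≡⟨ ℚP.+-identityʳ _ ⟩
    inv ⌜ N ⌝         ∎
    where
    open ≡-Reasoning

  afterDraw-dead : ∀ {N c} → k ℕ.< c → afterDraw N c false ≡ 0ℚ
  afterDraw-dead {N} {c} k<c =
    cong₂ _+_ (if-≟-≢ (ℕP.>⇒≢ (s≤s k<c))) (value-dead (ℕP.m<n⇒m<1+n k<c))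

  afterDraw-≤ : ∀ N c → c ℕ.≤ N →
                ⌜ c ⌝ * afterDraw (suc N) c true + ⌜ n ∸ c ⌝ * afterDraw (suc N) c false ≤ ⌜ n ⌝ * value N c
  afterDraw-≤ N c c≤N with ℕP.<-cmp c k
  ... | tri< c<k _ _ = begin
    ⌜ c ⌝ * value (suc N) c + ⌜ n ∸ c ⌝ * afterDraw (suc N) c false
      ≡⟨ cong₂ (λ a b → ⌜ c ⌝ * a + ⌜ n ∸ c ⌝ * b) (value-live (ℕP.<⇒≤ c<k)) (afterDraw-live c<k) ⟩
    ⌜ c ⌝ * h (suc N) c + ⌜ n ∸ c ⌝ * h (suc N) (suc c)  ≤⟨ draw N c c<k c≤N ⟩
    ⌜ n ⌝ * h N c                                        ≡⟨ cong (⌜ n ⌝ *_) (value-live (ℕP.<⇒≤ c<k)) ⟨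
    ⌜ n ⌝ * value N c                                    ∎
    where
    open ℚP.≤-Reasoning
  ... | tri≈ _ refl _ = begin
    ⌜ k ⌝ * value (suc N) k + ⌜ n ∸ k ⌝ * afterDraw (suc N) k false
      ≡⟨ cong₂ (λ a b → ⌜ k ⌝ * a + ⌜ n ∸ k ⌝ * b) (value-live ℕP.≤-refl) afterDraw-absorb ⟩
    ⌜ k ⌝ * h (suc N) k + ⌜ n ∸ k ⌝ * inv ⌜ suc N ⌝      ≤⟨ absorb N c≤N ⟩
    ⌜ n ⌝ * h N k                                        ≡⟨ cong (⌜ n ⌝ *_) (value-live ℕP.≤-refl) ⟨
    ⌜ n ⌝ * value N k                                    ∎
    where
    open ℚP.≤-Reasoning
  ... | tri> _ _ k<c = ℚP.≤-reflexive (begin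
    ⌜ c ⌝ * value (suc N) c + ⌜ n ∸ c ⌝ * afterDraw (suc N) c false
      ≡⟨ cong₂ (λ a b → ⌜ c ⌝ * a + ⌜ n ∸ c ⌝ * b) (value-dead k<c) (afterDraw-dead k<c) ⟩
    ⌜ c ⌝ * 0ℚ + ⌜ n ∸ c ⌝ * 0ℚ
      ≡⟨ solve 3 (λ c d n → c :* con 0ℚ :+ d :* con 0ℚ := n :* con 0ℚ) refl ⌜ c ⌝ ⌜ n ∸ c ⌝ ⌜ n ⌝ ⟩
    ⌜ n ⌝ * 0ℚ                                           ≡⟨ cong (⌜ n ⌝ *_) (value-dead k<c) ⟨
    ⌜ n ⌝ * value N c                                    ∎)
    where
    open ≡-Reasoning
    open +-*-Solver

  ∑-payoff-∷ʳ-≤ : ∀ N ψ → card ψ ℕ.≤ N → ∑[ x ∈ allFin n ] payoff (suc N) (ψ ∷ʳ x) ≤ ⌜ n ⌝ * value N (card ψ)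
  ∑-payoff-∷ʳ-≤ N ψ c≤N = begin
    ∑[ x ∈ allFin n ] payoff (suc N) (ψ ∷ʳ x)
      ≡⟨ ∑-cong (allFin n) (payoff-∷ʳ (suc N) ψ) ⟩
    ∑[ x ∈ allFin n ] after (does (x ∈? ψ))
      ≡⟨ ∑-split (_∈? ψ) (allFin n) after ⟩
    ⌜ length (filter (_∈? ψ) (allFin n)) ⌝ * after true + ⌜ length (filter (∁? (_∈? ψ)) (allFin n)) ⌝ * after false
      ≡⟨ cong₂ (λ a b → ⌜ a ⌝ * after true + ⌜ b ⌝ * after false) (length-members ψ) (length-nonMembers ψ) ⟩
    ⌜ card ψ ⌝ * after true + ⌜ n ∸ card ψ ⌝ * after false
      ≤⟨ afterDraw-≤ N (card ψ) c≤N ⟩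
    ⌜ n ⌝ * value N (card ψ) ∎
    where
    open ℚP.≤-Reasoning
    after : Bool → ℚ
    after = afterDraw (suc N) (card ψ)

  term-as-∑ : ∀ N → term n (suc k) N ≡
              inv ⌜ n ^ suc N ⌝ * ∑[ χ ∈ seqs n (suc N) ] (if inX (suc k) χ then inv ⌜ suc N ⌝ else 0ℚ)
  term-as-∑ N = begin
    ⌜ #in ⌝ * inv ⌜ suc N ℕ.* n ^ suc N ⌝             ≡⟨ cong (λ q → ⌜ #in ⌝ * inv q) (fromℕ-* (suc N) (n ^ suc N)) ⟩
    ⌜ #in ⌝ * inv (⌜ suc N ⌝ * ⌜ n ^ suc N ⌝)         ≡⟨ cong (⌜ #in ⌝ *_) (inv-* (fromℕ-pos {suc N} ℕ.z<s)
                                                                                  (fromℕ-pos {n ^ suc N} (^-pos (suc N) 0<n))) ⟩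
    ⌜ #in ⌝ * (inv ⌜ suc N ⌝ * inv ⌜ n ^ suc N ⌝)     ≡⟨ solve 4 (λ a b r p → a :* (r :* p) := p :* (a :* r :+ b :* con 0ℚ))
                                                            refl ⌜ #in ⌝ ⌜ #out ⌝ (inv ⌜ suc N ⌝) (inv ⌜ n ^ suc N ⌝) ⟩
    inv ⌜ n ^ suc N ⌝ * (⌜ #in ⌝ * inv ⌜ suc N ⌝ + ⌜ #out ⌝ * 0ℚ)
      ≡⟨ cong (inv ⌜ n ^ suc N ⌝ *_)
              (∑-split (T? ∘ inX (suc k)) (seqs n (suc N)) (λ b → if b then inv ⌜ suc N ⌝ else 0ℚ)) ⟨
    inv ⌜ n ^ suc N ⌝ * ∑[ χ ∈ seqs n (suc N) ] (if inX (suc k) χ then inv ⌜ suc N ⌝ else 0ℚ) ∎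
    where
    open ≡-Reasoning
    open +-*-Solver
    #in #out : ℕ
    #in = countX n (suc k) (suc N)
    #out = length (filter (∁? (T? ∘ inX (suc k))) (seqs n (suc N)))

  inv-^-suc : ∀ N → inv ⌜ n ^ suc N ⌝ * ⌜ n ⌝ ≡ inv ⌜ n ^ N ⌝
  inv-^-suc N = begin
    inv ⌜ n ℕ.* n ^ N ⌝ * ⌜ n ⌝            ≡⟨ cong (λ q → inv q * ⌜ n ⌝) (fromℕ-* n (n ^ N)) ⟩
    inv (⌜ n ⌝ * ⌜ n ^ N ⌝) * ⌜ n ⌝        ≡⟨ cong (_* ⌜ n ⌝) (inv-* (fromℕ-pos 0<n) (fromℕ-pos (^-pos N 0<n))) ⟩
    inv ⌜ n ⌝ * inv ⌜ n ^ N ⌝ * ⌜ n ⌝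
      ≡⟨ solve 3 (λ i j a → i :* j :* a := (a :* i) :* j) refl (inv ⌜ n ⌝) (inv ⌜ n ^ N ⌝) ⌜ n ⌝ ⟩
    ⌜ n ⌝ * inv ⌜ n ⌝ * inv ⌜ n ^ N ⌝      ≡⟨ cong (_* inv ⌜ n ^ N ⌝) (inv-inverseʳ (fromℕ-pos 0<n)) ⟩
    1ℚ * inv ⌜ n ^ N ⌝                     ≡⟨ ℚP.*-identityˡ _ ⟩
    inv ⌜ n ^ N ⌝                          ∎
    where
    open ≡-Reasoning
    open +-*-Solver

  potential : ℕ → ℚ
  potential N = partialE1/ℓ n (suc k) N + inv ⌜ n ^ N ⌝ * ∑[ ψ ∈ seqs n N ] value N (card ψ)

  potential-step : ∀ N → potential (suc N) ≤ potential N
  potential-step N = begin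
    potential (suc N)
      ≡⟨ ℚP.+-assoc partial _ _ ⟩
    partial + (term n (suc k) N + P * ∑[ χ ∈ seqs n (suc N) ] value (suc N) (card χ))
      ≡⟨ cong (λ t → partial + (t + P * ∑[ χ ∈ seqs n (suc N) ] value (suc N) (card χ))) (term-as-∑ N) ⟩
    partial + (P * ∑ (seqs n (suc N)) absorbed + P * ∑[ χ ∈ seqs n (suc N) ] value (suc N) (card χ))
      ≡⟨ cong (partial +_) (trans (sym (ℚP.*-distribˡ-+ P _ _))
                                  (cong (P *_) (sym (∑-+ (seqs n (suc N)) absorbed _)))) ⟩
    partial + P * ∑ (seqs n (suc N)) (payoff (suc N))
      ≡⟨ cong (λ s → partial + P * s) (∑-seqs-∷ʳ n N (payoff (suc N))) ⟩
    partial + P * ∑[ ψ ∈ seqs n N ] ∑[ x ∈ allFin n ] payoff (suc N) (ψ ∷ʳ x)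
      ≤⟨ ℚP.+-monoʳ-≤ partial (*-monoˡ-≤ (inv-nonNeg (fromℕ-nonNeg (n ^ suc N))) (∑-mono-≤ draw-from-seqs)) ⟩
    partial + P * ∑[ ψ ∈ seqs n N ] (⌜ n ⌝ * value N (card ψ))
      ≡⟨ cong (λ s → partial + P * s) (∑-*ˡ ⌜ n ⌝ (seqs n N) (value N ∘ card)) ⟩
    partial + P * (⌜ n ⌝ * alive)
      ≡⟨ cong (partial +_) (trans (sym (ℚP.*-assoc P ⌜ n ⌝ alive)) (cong (_* alive) (inv-^-suc N))) ⟩
    potential N ∎
    where
    open ℚP.≤-Reasoning
    partial P alive : ℚ
    partial = partialE1/ℓ n (suc k) N
    P = inv ⌜ n ^ suc N ⌝
    alive = ∑[ ψ ∈ seqs n N ] value N (card ψ)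
    absorbed : List (Fin n) → ℚ
    absorbed χ = if inX (suc k) χ then inv ⌜ suc N ⌝ else 0ℚ
    draw-from-seqs : ∀ {ψ} → ψ ∈ seqs n N → ∑[ x ∈ allFin n ] payoff (suc N) (ψ ∷ʳ x) ≤ ⌜ n ⌝ * value N (card ψ)
    draw-from-seqs {ψ} ψ∈ = ∑-payoff-∷ʳ-≤ N ψ (subst (card ψ ℕ.≤_) (length-∈-seqs ψ∈) (card≤length ψ))

  potential-≤-initial : ∀ N → potential N ≤ potential 0
  potential-≤-initial zero    = ℚP.≤-refl
  potential-≤-initial (suc N) = ℚP.≤-trans (potential-step N) (potential-≤-initial N)

  superharmonic⇒partialE1/ℓ-≤ : ∀ N → partialE1/ℓ n (suc k) N ≤ h 0 0
  superharmonic⇒partialE1/ℓ-≤ N = begin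
    partialE1/ℓ n (suc k) N
      ≤⟨ p≤p+q (*-nonNeg (inv-nonNeg (fromℕ-nonNeg (n ^ N)))
                          (∑-nonNeg {xs = seqs n N} (λ {ψ} _ → value-nonNeg N (card ψ)))) ⟩
    potential N              ≤⟨ potential-≤-initial N ⟩
    potential 0              ≡⟨ solve 1 (λ x → con 0ℚ :+ con 1ℚ :* (x :+ con 0ℚ) := x) refl (h 0 0) ⟩
    h 0 0                    ∎
    where
    open ℚP.≤-Reasoning
    open +-*-Solver

-- Expected waiting times and the majorant 1/(N + shift c)

/-suc-*-suc : ∀ a d → (ℤ.+ a) / suc d * ⌜ suc d ⌝ ≡ ⌜ a ⌝
/-suc-*-suc a d = ℚP.toℚᵘ-injective (begin-equality
  ℚ.toℚᵘ ((ℤ.+ a) / suc d * ⌜ suc d ⌝)           ≃⟨ ℚP.toℚᵘ-homo-* ((ℤ.+ a) / suc d) ⌜ suc d ⌝ ⟩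
  ℚ.toℚᵘ ((ℤ.+ a) / suc d) ℚᵘ.* ℚ.toℚᵘ ⌜ suc d ⌝  ≃⟨ ℚᵘP.*-cong (ℚP.toℚᵘ-fromℚᵘ (ℚᵘ.mkℚᵘ (ℤ.+ a) d))
                                                                 (ℚP.toℚᵘ-fromℚᵘ (ℚᵘ.mkℚᵘ (ℤ.+ suc d) 0)) ⟩
  ℚᵘ.mkℚᵘ (ℤ.+ a) d ℚᵘ.* ℚᵘ.mkℚᵘ (ℤ.+ suc d) 0     ≃⟨ ℚᵘ.*≡* cross ⟩
  ℚᵘ.mkℚᵘ (ℤ.+ a) 0                               ≃⟨ ℚP.toℚᵘ-fromℚᵘ (ℚᵘ.mkℚᵘ (ℤ.+ a) 0) ⟨
  ℚ.toℚᵘ ⌜ a ⌝                                    ∎)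
  where
  open ℚᵘP.≤-Reasoning
  cross : (ℤ.+ a ℤ.* ℤ.+ suc d) ℤ.* ℤ.+ 1 ≡ ℤ.+ a ℤ.* ℤ.+ suc (d ℕ.* 1)
  cross rewrite ℕP.*-identityʳ d = ℤP.*-identityʳ _

/-suc≡*inv : ∀ a d → (ℤ.+ a) / suc d ≡ ⌜ a ⌝ * inv ⌜ suc d ⌝
/-suc≡*inv a d = begin
  q                                      ≡⟨ ℚP.*-identityʳ q ⟨
  q * 1ℚ                                 ≡⟨ cong (q *_) (inv-inverseʳ (fromℕ-pos {suc d} ℕ.z<s)) ⟨
  q * (⌜ suc d ⌝ * inv ⌜ suc d ⌝)        ≡⟨ ℚP.*-assoc q _ _ ⟨
  q * ⌜ suc d ⌝ * inv ⌜ suc d ⌝          ≡⟨ cong (_* inv ⌜ suc d ⌝) (/-suc-*-suc a d) ⟩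
  ⌜ a ⌝ * inv ⌜ suc d ⌝                  ∎
  where
  open ≡-Reasoning
  q : ℚ
  q = (ℤ.+ a) / suc d

Eℓ-suc : ∀ {n c} → c ℕ.< n → Eℓ n (suc c) ≡ Eℓ n c + ⌜ n ⌝ * inv ⌜ n ∸ c ⌝
Eℓ-suc {n} {c} c<n = cong (Eℓ n c +_) (begin
  (ℤ.+ n) / suc (n ∸ suc c)               ≡⟨ /-suc≡*inv n (n ∸ suc c) ⟩
  ⌜ n ⌝ * inv ⌜ suc (n ∸ suc c) ⌝         ≡⟨ cong (λ a → ⌜ n ⌝ * inv ⌜ a ⌝) (ℕP.+-∸-assoc 1 c<n) ⟨
  ⌜ n ⌝ * inv ⌜ n ∸ c ⌝                   ∎)
  where
  open ≡-Reasoning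

Eℓ-growth : ∀ {n} c r → c ℕ.+ r ℕ.≤ n → Eℓ n c + ⌜ r ⌝ * (⌜ n ⌝ * inv ⌜ n ∸ c ⌝) ≤ Eℓ n (c ℕ.+ r)
Eℓ-growth {n} c zero _ rewrite ℕP.+-identityʳ c =
  ℚP.≤-reflexive (solve 2 (λ e v → e :+ con 0ℚ :* v := e) refl (Eℓ n c) (⌜ n ⌝ * inv ⌜ n ∸ c ⌝))
  where
  open +-*-Solver
Eℓ-growth {n} c (suc r) c+r<n rewrite ℕP.+-suc c r = begin
  Eℓ n c + ⌜ suc r ⌝ * ν                      ≡⟨ cong (λ a → Eℓ n c + a * ν) (fromℕ-suc r) ⟩
  Eℓ n c + (1ℚ + ⌜ r ⌝) * ν
    ≡⟨ solve 3 (λ e r v → e :+ (con 1ℚ :+ r) :* v := e :+ r :* v :+ v) refl (Eℓ n c) ⌜ r ⌝ ν ⟩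
  Eℓ n c + ⌜ r ⌝ * ν + ν
    ≤⟨ ℚP.+-mono-≤ (Eℓ-growth c r (ℕP.<⇒≤ c+r<n)) (*-monoˡ-≤ (fromℕ-nonNeg n) ν≤) ⟩
  Eℓ n (c ℕ.+ r) + ⌜ n ⌝ * inv ⌜ n ∸ (c ℕ.+ r) ⌝  ≡⟨ Eℓ-suc c+r<n ⟨
  Eℓ n (suc (c ℕ.+ r))                        ∎
  where
  open ℚP.≤-Reasoning
  open +-*-Solver
  ν : ℚ
  ν = ⌜ n ⌝ * inv ⌜ n ∸ c ⌝
  ν≤ : inv ⌜ n ∸ c ⌝ ≤ inv ⌜ n ∸ (c ℕ.+ r) ⌝
  ν≤ = inv-antimono-≤ (fromℕ-∸-pos c+r<n) (fromℕ-mono-≤ (ℕP.∸-monoʳ-≤ n (ℕP.m≤m+n c r)))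

absorb-identity : ∀ {k t n d} N iD → n ≡ k + t → d ≡ k * t + n → d * iD ≡ 1ℚ →
                  let x = N + (1ℚ + k) * n * iD in
                  k * (1ℚ + N) ≡ t * (x + 1ℚ) * (x - (1ℚ + N)) + k * n * iD * ((N - k) + (1ℚ + k) * n * iD)
absorb-identity {k} {t} N iD refl refl diD≡1 = begin
  k * (1ℚ + N)
    ≡⟨ solve 4 (λ k t N iD → let n = k :+ t ; x = N :+ (con 1ℚ :+ k) :* n :* iD in
         k :* (con 1ℚ :+ N)
         := t :* (x :+ con 1ℚ) :* (x :- (con 1ℚ :+ N)) :+ k :* n :* iD :* ((N :- k) :+ (con 1ℚ :+ k) :* n :* iD)
            :+ (con 1ℚ :- (k :* t :+ n) :* iD) :* (k :* iD :* (con 1ℚ :+ k) :* n :+ k :* (con 1ℚ :+ N) :+ t :* (x :+ con 1ℚ)))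
         refl k t N iD ⟩
  rhs + (1ℚ - (k * t + n) * iD) * Q   ≡⟨ cong (λ e → rhs + (1ℚ - e) * Q) diD≡1 ⟩
  rhs + (1ℚ - 1ℚ) * Q                 ≡⟨ solve 2 (λ r Q → r :+ (con 1ℚ :- con 1ℚ) :* Q := r) refl rhs Q ⟩
  rhs                                 ∎
  where
  open ≡-Reasoning
  open +-*-Solver
  n x rhs Q : ℚ
  n = k + t
  x = N + (1ℚ + k) * n * iD
  rhs = t * (x + 1ℚ) * (x - (1ℚ + N)) + k * n * iD * ((N - k) + (1ℚ + k) * n * iD)
  Q = k * iD * (1ℚ + k) * n + k * (1ℚ + N) + t * (x + 1ℚ)

shift-gap-identity : ∀ {c j j₁ u w s e N n} → j ≡ 1ℚ + j₁ → n ≡ c + j → j * u ≡ 1ℚ → j₁ * w ≡ 1ℚ →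
                     (N + (e + s * u)) - ((1ℚ + N) + ((e - n * u) + s * w)) ≡ u * (c - s * w)
shift-gap-identity {c} {j} {j₁} {u} {w} {s} {e} {N} refl refl ju≡1 j₁w≡1 = begin
  (N + (e + s * u)) - ((1ℚ + N) + ((e - (c + (1ℚ + j₁)) * u) + s * w))
    ≡⟨ solve 7 (λ c j₁ u w s e N →
         (N :+ (e :+ s :* u)) :- ((con 1ℚ :+ N) :+ ((e :- (c :+ (con 1ℚ :+ j₁)) :* u) :+ s :* w))
         := u :* (c :- s :* w) :+ ((con 1ℚ :+ j₁) :* u :- con 1ℚ) :* (con 1ℚ :+ s :* w) :+ s :* u :* (con 1ℚ :- j₁ :* w))
         refl c j₁ u w s e N ⟩
  u * (c - s * w) + ((1ℚ + j₁) * u - 1ℚ) * (1ℚ + s * w) + s * u * (1ℚ - j₁ * w)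
    ≡⟨ cong₂ (λ a b → u * (c - s * w) + (a - 1ℚ) * (1ℚ + s * w) + s * u * (1ℚ - b)) ju≡1 j₁w≡1 ⟩
  u * (c - s * w) + (1ℚ - 1ℚ) * (1ℚ + s * w) + s * u * (1ℚ - 1ℚ)
    ≡⟨ solve 5 (λ a c s w u → a :+ (con 1ℚ :- con 1ℚ) :* (con 1ℚ :+ s :* w) :+ s :* u :* (con 1ℚ :- con 1ℚ) := a)
         refl (u * (c - s * w)) c s w u ⟩
  u * (c - s * w) ∎
  where
  open ≡-Reasoning
  open +-*-Solver

-- With k = c + 1 + r and n = k + 1 + u the gap is a polynomial with nonnegative coefficients.
draw-polynomial-≤ : ∀ c r u {k n t j j₁ kc} → k ≡ suc (c ℕ.+ r) → t ≡ suc u → n ≡ k ℕ.+ t →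
                    j₁ ≡ r ℕ.+ t → j ≡ suc j₁ → kc ≡ suc r →
                    c ℕ.* j₁ ℕ.* (k ℕ.* t ℕ.+ n) ℕ.≤ suc k ℕ.* t ℕ.* (j ℕ.* suc c ℕ.+ kc ℕ.* n)
draw-polynomial-≤ c r u refl refl refl refl refl refl = ℕP.≤-trans (ℕP.m≤m+n _ gap) (ℕP.≤-reflexive (sym
  (solve 3 (λ c r u → let k = con 1 :+ (c :+ r) ; t = con 1 :+ u ; n = k :+ t ; j₁ = r :+ t in
              (con 1 :+ k) :* t :* ((con 1 :+ j₁) :* (con 1 :+ c) :+ (con 1 :+ r) :* n)
              := c :* j₁ :* (k :* t :+ n)
                 :+ (t :* ((con 1 :+ k) :* (con 1 :+ c) :+ j₁ :* ((con 1 :+ k) :+ c))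
                     :+ n :* (c :* r :* u :+ (con 2 :+ r) :* (con 1 :+ r) :* t)))
     refl c r u)))
  where
  open ℕS.+-*-Solver
  k t n j₁ gap : ℕ
  k = suc (c ℕ.+ r)
  t = suc u
  n = k ℕ.+ t
  j₁ = r ℕ.+ t
  gap = t ℕ.* (suc k ℕ.* suc c ℕ.+ j₁ ℕ.* (suc k ℕ.+ c))
        ℕ.+ n ℕ.* (c ℕ.* r ℕ.* u ℕ.+ (2 ℕ.+ r) ℕ.* suc r ℕ.* t)

module Majorant {n k : ℕ} (0<k : 0 ℕ.< k) (k<n : k ℕ.< n) where

  k̂ t̂ n̂ d̂ : ℚ
  k̂ = ⌜ k ⌝
  t̂ = ⌜ n ∸ k ⌝
  n̂ = ⌜ n ⌝
  d̂ = k̂ * t̂ + n̂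

  τ : ℚ
  τ = (1ℚ + k̂) * n̂ * inv d̂

  shift : ℕ → ℚ
  shift c = (Eℓ n k - Eℓ n c) + τ * t̂ * inv ⌜ n ∸ c ⌝

  h : ℕ → ℕ → ℚ
  h N c = inv (⌜ N ⌝ + shift c)

  0<n : 0 ℕ.< n
  0<n = ℕP.<-trans 0<k k<n

  t̂-pos : 0ℚ < t̂
  t̂-pos = fromℕ-∸-pos k<n

  n̂-pos : 0ℚ < n̂
  n̂-pos = fromℕ-pos 0<n

  d̂-pos : 0ℚ < d̂
  d̂-pos = +-nonNeg-pos (*-nonNeg (fromℕ-nonNeg k) (ℚP.<⇒≤ t̂-pos)) n̂-pos

  τ-pos : 0ℚ < τ
  τ-pos = *-pos (*-pos (ℚP.<-≤-trans (ℚP.positive⁻¹ 1ℚ) (p≤p+q (fromℕ-nonNeg k))) n̂-pos) (inv-pos d̂-pos)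

  n̂≡k̂+t̂ : n̂ ≡ k̂ + t̂
  n̂≡k̂+t̂ = trans (cong ⌜_⌝ (sym (ℕP.m+[n∸m]≡n (ℕP.<⇒≤ k<n)))) (fromℕ-+ k (n ∸ k))

  Eℓ-remaining : ∀ c → c ℕ.≤ k → ⌜ k ∸ c ⌝ * (n̂ * inv ⌜ n ∸ c ⌝) ≤ Eℓ n k - Eℓ n c
  Eℓ-remaining c c≤k = p+q≤r⇒q≤r-p
    (subst (λ m → Eℓ n c + ⌜ k ∸ c ⌝ * (n̂ * inv ⌜ n ∸ c ⌝) ≤ Eℓ n m) (ℕP.m+[n∸m]≡n c≤k)
           (Eℓ-growth c (k ∸ c) (subst (ℕ._≤ n) (sym (ℕP.m+[n∸m]≡n c≤k)) (ℕP.<⇒≤ k<n))))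

  shift-pos : ∀ c → c ℕ.≤ k → 0ℚ < shift c
  shift-pos c c≤k = +-nonNeg-pos
    (ℚP.≤-trans (*-nonNeg (fromℕ-nonNeg (k ∸ c)) (*-nonNeg (fromℕ-nonNeg n) (inv-nonNeg (fromℕ-nonNeg (n ∸ c)))))
                (Eℓ-remaining c c≤k))
    (*-pos (*-pos τ-pos t̂-pos) (inv-pos (fromℕ-∸-pos (ℕP.≤-<-trans c≤k k<n))))

  shift-last : shift k ≡ τ
  shift-last = begin
    (Eℓ n k - Eℓ n k) + τ * t̂ * inv t̂
      ≡⟨ solve 4 (λ e τ t i → (e :- e) :+ τ :* t :* i := τ :* (t :* i)) refl (Eℓ n k) τ t̂ (inv t̂) ⟩
    τ * (t̂ * inv t̂)                     ≡⟨ cong (τ *_) (inv-inverseʳ t̂-pos) ⟩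
    τ * 1ℚ                              ≡⟨ ℚP.*-identityʳ τ ⟩
    τ                                   ∎
    where
    open ≡-Reasoning
    open +-*-Solver

  absorb : ∀ N → k ℕ.≤ N → k̂ * h (suc N) k + t̂ * inv ⌜ suc N ⌝ ≤ n̂ * h N k
  absorb N k≤N = begin
    k̂ * inv (⌜ suc N ⌝ + shift k) + t̂ * inv ⌜ suc N ⌝
      ≡⟨ cong₂ (λ a b → k̂ * inv a + t̂ * inv b) x+1≡ (fromℕ-suc N) ⟩
    k̂ * inv (x + 1ℚ) + t̂ * inv y    ≤⟨ weighted-inv-≤ {k̂} {t̂} {x} {y} x-pos y-pos cond ⟩
    (k̂ + t̂) * inv x                 ≡⟨ cong₂ (λ a b → a * inv (⌜ N ⌝ + b)) n̂≡k̂+t̂ shift-last ⟨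
    n̂ * inv (⌜ N ⌝ + shift k)       ∎
    where
    open ℚP.≤-Reasoning
    x y gap : ℚ
    x = ⌜ N ⌝ + τ
    y = 1ℚ + ⌜ N ⌝
    gap = k̂ * n̂ * inv d̂ * ((⌜ N ⌝ - k̂) + τ)
    x-pos : 0ℚ < x
    x-pos = +-nonNeg-pos (fromℕ-nonNeg N) τ-pos
    y-pos : 0ℚ < y
    y-pos = subst (0ℚ <_) (fromℕ-suc N) (fromℕ-pos {suc N} ℕ.z<s)
    x+1≡ : ⌜ suc N ⌝ + shift k ≡ x + 1ℚ
    x+1≡ = trans (cong₂ _+_ (fromℕ-suc N) shift-last)
                 (solve 2 (λ N τ → (con 1ℚ :+ N) :+ τ := N :+ τ :+ con 1ℚ) refl ⌜ N ⌝ τ)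
      where
      open +-*-Solver
    0≤gap : 0ℚ ≤ gap
    0≤gap = *-nonNeg (*-nonNeg (*-nonNeg (fromℕ-nonNeg k) (fromℕ-nonNeg n)) (inv-nonNeg (ℚP.<⇒≤ d̂-pos)))
                     (+-nonNeg (p≤q⇒0≤q-p (fromℕ-mono-≤ k≤N)) (ℚP.<⇒≤ τ-pos))
    cond : t̂ * (x + 1ℚ) * (x - y) ≤ k̂ * y
    cond = p+g≡q⇒p≤q gap 0≤gap (sym (absorb-identity {k̂} {t̂} ⌜ N ⌝ (inv d̂) n̂≡k̂+t̂ refl (inv-inverseʳ d̂-pos)))

  -- Here x − y = (c − q)/(n − c), and the condition of weighted-inv-≤ reduces to c·n/(n − c) ≤ q (x + 1),
  -- which after clearing denominators is draw-polynomial-≤.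
  module DrawStep {N c : ℕ} (c<k : c ℕ.< k) (c≤N : c ℕ.≤ N) where

    c<n : c ℕ.< n
    c<n = ℕP.<-trans c<k k<n

    ĉ ĵ ĵ₁ r̂ u w s q e x y : ℚ
    ĉ = ⌜ c ⌝
    ĵ = ⌜ n ∸ c ⌝
    ĵ₁ = ⌜ n ∸ suc c ⌝
    r̂ = ⌜ k ∸ c ⌝
    u = inv ĵ
    w = inv ĵ₁
    s = τ * t̂
    q = s * w
    e = Eℓ n k - Eℓ n c
    x = ⌜ N ⌝ + shift c
    y = ⌜ suc N ⌝ + shift (suc c)

    n̂≡ĉ+ĵ : n̂ ≡ ĉ + ĵ
    n̂≡ĉ+ĵ = trans (cong ⌜_⌝ (sym (ℕP.m+[n∸m]≡n (ℕP.<⇒≤ c<n)))) (fromℕ-+ c (n ∸ c))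

    ĵ≡1+ĵ₁ : ĵ ≡ 1ℚ + ĵ₁
    ĵ≡1+ĵ₁ = trans (cong ⌜_⌝ (ℕP.+-∸-assoc 1 c<n)) (fromℕ-suc (n ∸ suc c))

    ĵu≡1 : ĵ * u ≡ 1ℚ
    ĵu≡1 = inv-inverseʳ (fromℕ-∸-pos c<n)

    ĵ₁w≡1 : ĵ₁ * w ≡ 1ℚ
    ĵ₁w≡1 = inv-inverseʳ (fromℕ-∸-pos (ℕP.≤-<-trans c<k k<n))

    0≤u : 0ℚ ≤ u
    0≤u = inv-nonNeg (fromℕ-nonNeg (n ∸ c))

    0≤q : 0ℚ ≤ q
    0≤q = *-nonNeg (*-nonNeg (ℚP.<⇒≤ τ-pos) (ℚP.<⇒≤ t̂-pos)) (inv-nonNeg (fromℕ-nonNeg (n ∸ suc c)))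

    x-y≡ : x - y ≡ u * (ĉ - q)
    x-y≡ = trans (cong (x -_) y≡)
                 (shift-gap-identity {ĉ} {ĵ} {ĵ₁} {u} {w} {s} {e} {⌜ N ⌝} {n̂} ĵ≡1+ĵ₁ n̂≡ĉ+ĵ ĵu≡1 ĵ₁w≡1)
      where
      open +-*-Solver
      y≡ : y ≡ (1ℚ + ⌜ N ⌝) + ((e - n̂ * u) + s * w)
      y≡ = cong₂ _+_ (fromℕ-suc N) (cong (_+ s * w) (trans (cong (Eℓ n k -_) (Eℓ-suc c<n))
             (solve 3 (λ μ a v → μ :- (a :+ v) := μ :- a :- v) refl (Eℓ n k) (Eℓ n c) (n̂ * u))))

    polynomial : ĉ * ĵ₁ * d̂ ≤ (1ℚ + k̂) * t̂ * (ĵ * (1ℚ + ĉ) + r̂ * n̂)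
    polynomial = subst₂ _≤_ cast₁ cast₂ (fromℕ-mono-≤ (draw-polynomial-≤ c (k ∸ suc c) (n ∸ suc k)
      (sym (ℕP.m+[n∸m]≡n c<k)) (ℕP.+-∸-assoc 1 k<n) (sym (ℕP.m+[n∸m]≡n (ℕP.<⇒≤ k<n))) j₁≡
      (ℕP.+-∸-assoc 1 c<n) (ℕP.+-∸-assoc 1 c<k)))
      where
      j₁≡ : n ∸ suc c ≡ k ∸ suc c ℕ.+ (n ∸ k)
      j₁≡ = trans (cong (_∸ suc c) (sym (ℕP.m∸n+n≡m (ℕP.<⇒≤ k<n))))
                  (trans (ℕP.+-∸-assoc (n ∸ k) c<k) (ℕP.+-comm (n ∸ k) (k ∸ suc c)))
      cast₁ : ⌜ c ℕ.* (n ∸ suc c) ℕ.* (k ℕ.* (n ∸ k) ℕ.+ n) ⌝ ≡ ĉ * ĵ₁ * d̂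
      cast₁ = trans (fromℕ-* (c ℕ.* (n ∸ suc c)) _)
                    (cong₂ _*_ (fromℕ-* c (n ∸ suc c))
                               (trans (fromℕ-+ (k ℕ.* (n ∸ k)) n) (cong (_+ n̂) (fromℕ-* k (n ∸ k)))))
      cast₂ : ⌜ suc k ℕ.* (n ∸ k) ℕ.* ((n ∸ c) ℕ.* suc c ℕ.+ (k ∸ c) ℕ.* n) ⌝
            ≡ (1ℚ + k̂) * t̂ * (ĵ * (1ℚ + ĉ) + r̂ * n̂)
      cast₂ = trans (fromℕ-* (suc k ℕ.* (n ∸ k)) _)
                    (cong₂ _*_ (trans (fromℕ-* (suc k) (n ∸ k)) (cong (_* t̂) (fromℕ-suc k)))
                               (trans (fromℕ-+ ((n ∸ c) ℕ.* suc c) _)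
                                      (cong₂ _+_ (trans (fromℕ-* (n ∸ c) (suc c)) (cong (ĵ *_) (fromℕ-suc c)))
                                                 (fromℕ-* (k ∸ c) n))))

    Z : ℚ
    Z = n̂ * u * w * inv d̂

    0≤Z : 0ℚ ≤ Z
    0≤Z = *-nonNeg (*-nonNeg (*-nonNeg (fromℕ-nonNeg n) 0≤u) (inv-nonNeg (fromℕ-nonNeg (n ∸ suc c))))
                   (inv-nonNeg (ℚP.<⇒≤ d̂-pos))

    cleared-lhs : ĉ * u * n̂ ≡ ĉ * ĵ₁ * d̂ * Z
    cleared-lhs = begin
      ĉ * u * n̂                               ≡⟨ solve 3 (λ c u n → c :* u :* n := c :* u :* n :* con 1ℚ :* con 1ℚ) refl ĉ u n̂ ⟩
      ĉ * u * n̂ * 1ℚ * 1ℚ                     ≡⟨ cong₂ (λ a b → ĉ * u * n̂ * a * b) ĵ₁w≡1 (inv-inverseʳ d̂-pos) ⟨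
      ĉ * u * n̂ * (ĵ₁ * w) * (d̂ * inv d̂)     ≡⟨ solve 7 (λ c u n j₁ w d iD → c :* u :* n :* (j₁ :* w) :* (d :* iD)
                                                    := c :* j₁ :* d :* (n :* u :* w :* iD)) refl ĉ u n̂ ĵ₁ w d̂ (inv d̂) ⟩
      ĉ * ĵ₁ * d̂ * Z                          ∎
      where
      open ≡-Reasoning
      open +-*-Solver

    cleared-rhs : (1ℚ + k̂) * t̂ * (ĵ * (1ℚ + ĉ) + r̂ * n̂) * Z ≡ q * (1ℚ + ĉ + r̂ * (n̂ * u))
    cleared-rhs = begin
      (1ℚ + k̂) * t̂ * (ĵ * (1ℚ + ĉ) + r̂ * n̂) * Z
        ≡⟨ solve 9 (λ k t j c r n u w iD → (con 1ℚ :+ k) :* t :* (j :* (con 1ℚ :+ c) :+ r :* n) :* (n :* u :* w :* iD)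
                      := (con 1ℚ :+ k) :* n :* iD :* t :* w :* ((j :* u) :* (con 1ℚ :+ c) :+ r :* (n :* u)))
             refl k̂ t̂ ĵ ĉ r̂ n̂ u w (inv d̂) ⟩
      τ * t̂ * w * ((ĵ * u) * (1ℚ + ĉ) + r̂ * (n̂ * u))
        ≡⟨ cong (λ a → τ * t̂ * w * (a * (1ℚ + ĉ) + r̂ * (n̂ * u))) ĵu≡1 ⟩
      τ * t̂ * w * (1ℚ * (1ℚ + ĉ) + r̂ * (n̂ * u))
        ≡⟨ cong (λ a → τ * t̂ * w * (a + r̂ * (n̂ * u))) (ℚP.*-identityˡ (1ℚ + ĉ)) ⟩
      q * (1ℚ + ĉ + r̂ * (n̂ * u))              ∎
      where
      open ≡-Reasoning
      open +-*-Solver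

    1+ĉ+r̂n̂u≤x+1 : 1ℚ + ĉ + r̂ * (n̂ * u) ≤ x + 1ℚ
    1+ĉ+r̂n̂u≤x+1 = p+g≡q⇒p≤q ((⌜ N ⌝ - ĉ) + (e - r̂ * (n̂ * u)) + s * u)
      (+-nonNeg (+-nonNeg (p≤q⇒0≤q-p (fromℕ-mono-≤ c≤N)) (p≤q⇒0≤q-p (Eℓ-remaining c (ℕP.<⇒≤ c<k))))
                (*-nonNeg (*-nonNeg (ℚP.<⇒≤ τ-pos) (ℚP.<⇒≤ t̂-pos)) 0≤u))
      (solve 6 (λ c g N e s u → con 1ℚ :+ c :+ g :+ ((N :- c) :+ (e :- g) :+ s :* u) := N :+ (e :+ s :* u) :+ con 1ℚ)
         refl ĉ (r̂ * (n̂ * u)) ⌜ N ⌝ e s u)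
      where open +-*-Solver

    ĉun̂≤q[x+1] : ĉ * u * (ĉ + ĵ) ≤ q * (x + 1ℚ) + ĉ * u * q
    ĉun̂≤q[x+1] = begin
      ĉ * u * (ĉ + ĵ)                                     ≡⟨ cong (ĉ * u *_) n̂≡ĉ+ĵ ⟨
      ĉ * u * n̂                                           ≡⟨ cleared-lhs ⟩
      ĉ * ĵ₁ * d̂ * Z                                      ≤⟨ *-monoʳ-≤ 0≤Z polynomial ⟩
      (1ℚ + k̂) * t̂ * (ĵ * (1ℚ + ĉ) + r̂ * n̂) * Z         ≡⟨ cleared-rhs ⟩
      q * (1ℚ + ĉ + r̂ * (n̂ * u))                          ≤⟨ *-monoˡ-≤ 0≤q 1+ĉ+r̂n̂u≤x+1 ⟩
      q * (x + 1ℚ)                                        ≤⟨ p≤p+q (*-nonNeg (*-nonNeg (fromℕ-nonNeg c) 0≤u) 0≤q) ⟩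
      q * (x + 1ℚ) + ĉ * u * q                            ∎
      where open ℚP.≤-Reasoning

    condition : ĵ * (x + 1ℚ) * (x - y) ≤ ĉ * y
    condition = subst₂ (λ Δ z → ĵ * (x + 1ℚ) * Δ ≤ ĉ * z) (sym x-y≡)
                  (trans (cong (x -_) (sym x-y≡)) (solve 2 (λ x y → x :- (x :- y) := y) refl x y))
                  (weighted-inv-condition {ĉ} {ĵ} {u} {q} {x} ĵu≡1 ĉun̂≤q[x+1])
      where open +-*-Solver

    draw-step : ĉ * h (suc N) c + ĵ * h (suc N) (suc c) ≤ n̂ * h N c
    draw-step = begin
      ĉ * inv (⌜ suc N ⌝ + shift c) + ĵ * inv y   ≡⟨ cong (λ a → ĉ * inv a + ĵ * inv y) x+1≡ ⟩
      ĉ * inv (x + 1ℚ) + ĵ * inv y                ≤⟨ weighted-inv-≤ {ĉ} {ĵ} {x} {y} x-pos y-pos condition ⟩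
      (ĉ + ĵ) * inv x                             ≡⟨ cong (_* inv x) n̂≡ĉ+ĵ ⟨
      n̂ * inv x                                   ∎
      where
      open ℚP.≤-Reasoning
      x-pos : 0ℚ < x
      x-pos = +-nonNeg-pos (fromℕ-nonNeg N) (shift-pos c (ℕP.<⇒≤ c<k))
      y-pos : 0ℚ < y
      y-pos = +-nonNeg-pos (fromℕ-nonNeg (suc N)) (shift-pos (suc c) c<k)
      x+1≡ : ⌜ suc N ⌝ + shift c ≡ x + 1ℚ
      x+1≡ = trans (cong (_+ shift c) (fromℕ-suc N))
                   (solve 2 (λ N s → (con 1ℚ :+ N) :+ s := N :+ s :+ con 1ℚ) refl ⌜ N ⌝ (shift c))
        where open +-*-Solver

  draw : ∀ N c → c ℕ.< k → c ℕ.≤ N → ⌜ c ⌝ * h (suc N) c + ⌜ n ∸ c ⌝ * h (suc N) (suc c) ≤ n̂ * h N c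
  draw N c c<k c≤N = DrawStep.draw-step c<k c≤N

  superharmonic : Superharmonic n k h
  superharmonic = record
    { nonNeg = λ N c c≤k → inv-nonNeg (ℚP.<⇒≤ (+-nonNeg-pos (fromℕ-nonNeg N) (shift-pos c c≤k)))
    ; draw   = draw
    ; absorb = absorb
    }

  δ : ℚ
  δ = τ * t̂ * inv n̂

  δ-pos : 0ℚ < δ
  δ-pos = *-pos (*-pos τ-pos t̂-pos) (inv-pos n̂-pos)

  Eℓ-pos : 0ℚ < Eℓ n k
  Eℓ-pos = ℚP.<-≤-trans (fromℕ-pos 0<k) (begin
    k̂                                 ≡⟨ solve 1 (λ k → k := con 0ℚ :+ k :* con 1ℚ) refl k̂ ⟩
    0ℚ + k̂ * 1ℚ                       ≡⟨ cong (λ a → 0ℚ + k̂ * a) (inv-inverseʳ n̂-pos) ⟨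
    0ℚ + k̂ * (n̂ * inv n̂)              ≤⟨ Eℓ-growth 0 k (ℕP.<⇒≤ k<n) ⟩
    Eℓ n k                            ∎)
    where
    open ℚP.≤-Reasoning
    open +-*-Solver

  partialE1/ℓ≤inv[Eℓ+δ] : ∀ N → partialE1/ℓ n (suc k) N ≤ inv (Eℓ n k + δ)
  partialE1/ℓ≤inv[Eℓ+δ] N =
    subst (partialE1/ℓ n (suc k) N ≤_) h₀₀≡ (superharmonic⇒partialE1/ℓ-≤ 0<n superharmonic N)
    where
    h₀₀≡ : h 0 0 ≡ inv (Eℓ n k + δ)
    h₀₀≡ = cong inv (solve 2 (λ μ d → con 0ℚ :+ ((μ :- con 0ℚ) :+ d) := μ :+ d) refl (Eℓ n k) δ)
      where
      open +-*-Solver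

-- The bound E_m[1/ℓ] ≤ 1/(E_{m−1}[ℓ] + δ) holds for every 1 < m ≤ n.
lemma2p6 : (n m : ℕ) → 1 ℕ.< m → m ℕ.≤ n →
    (m ℕ.* m ℕ.< 2 ℕ.* n →
      Σ ℚ (λ ε → 0ℚ ℚ.< ε × ((N : ℕ) → partialE1/ℓ n m N ℚ.≤ inv (Eℓ n (m ∸ 1)) - ε)))
    × ((N : ℕ) → partialE1/ℓ n m N ℚ.≤
        inv (Eℓ n (m ∸ 1)) + fromℕ ((m ∸ 1) ℕ.* (n ∸ m)) * inv (fromℕ (2 ℕ.* n ℕ.* n)))
lemma2p6 n (suc k) (s≤s 0<k) k<n = (λ _ → ε , ε-pos , bound-ε) , bound-slack
  where
  open Majorant 0<k k<n
  μ ε : ℚ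
  μ = Eℓ n k
  ε = inv μ - inv (μ + δ)
  ε-pos : 0ℚ < ε
  ε-pos = p<q⇒0<q-p (inv-antimono-< Eℓ-pos (p<p+q δ-pos))
  bound-ε : ∀ N → partialE1/ℓ n (suc k) N ≤ inv μ - ε
  bound-ε N = subst (partialE1/ℓ n (suc k) N ≤_) (solve 2 (λ a b → b := a :- (a :- b)) refl (inv μ) (inv (μ + δ)))
                    (partialE1/ℓ≤inv[Eℓ+δ] N)
    where
    open +-*-Solver
  bound-slack : ∀ N → partialE1/ℓ n (suc k) N ≤ inv μ + fromℕ (k ℕ.* (n ∸ suc k)) * inv (fromℕ (2 ℕ.* n ℕ.* n))
  bound-slack N = begin
    partialE1/ℓ n (suc k) N   ≤⟨ partialE1/ℓ≤inv[Eℓ+δ] N ⟩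
    inv (μ + δ)               ≤⟨ inv-antimono-≤ Eℓ-pos (ℚP.<⇒≤ (p<p+q δ-pos)) ⟩
    inv μ                     ≤⟨ p≤p+q (*-nonNeg (fromℕ-nonNeg (k ℕ.* (n ∸ suc k)))
                                                  (inv-nonNeg (fromℕ-nonNeg (2 ℕ.* n ℕ.* n)))) ⟩
    inv μ + fromℕ (k ℕ.* (n ∸ suc k)) * inv (fromℕ (2 ℕ.* n ℕ.* n)) ∎
    where
    open ℚP.≤-Reasoning
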